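{- Let $(S,\bullet)$ be a partial semigroup. The following are equivalent: (a) $(S,\bullet)$ is a partial group; (b) there is a two-sided identity $e$ for $S$ such that for each $x\in S$ there is some $y\in R(x)\cap L(x)$ which is a two-sided $e$-inverse for $x$; (c) there is a left identity for $S$, and given any left identity $e$ for $S$ and any $x\in S$ there is some $y\in L(x)$ which is a left $e$-inverse for $x$.
   Context: A partial semigroup is a nonempty set $S$ with a partially defined operation $\bullet$ such that $(x\bullet y)\bullet z=x\bullet(y\bullet z)$ in the sense that if either side is defined so is the other and they are equal. $R(x)=\{s:x\bullet s\text{ defined}\}$, $L(x)=\{s:s\bullet x\text{ defined}\}$. An idempotent is $e$ with $e\bullet e=e$. A left identity is $e\in S$ with $e\in L(s)$ and $e\bullet s=s$ for all $s\in S$; a right identity similarly with $e\in R(s)$, $s\bullet e=s$; a two-sided identity is both. For an element $e$, $y$ is a left $e$-inverse of $x$ if $y\in L(x)$ and $y\bullet x=e$, a right $e$-inverse if $y\in R(x)$ and $x\bullet y=e$, and a two-sided $e$-inverse if both. $(S,\bullet)$ is a partial group if there is an idempotent left identity $e$ such that every $x\in S$ has a left $e$-inverse. -}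

module Defs where

open import Level using (Level; suc; _⊔_)
open import Data.Maybe using (Maybe; just; nothing; _>>=_)
open import Data.Product using (Σ; ∃; _×_; _,_)
open import Relation.Binary.PropositionalEquality using (_≡_)

-- Associativity in the partial sense: (x•y)•z is defined iff x•(y•z) is, and then they agree.
-- With Maybe-bind this is exactly an equality of Maybe values.
record PartialSemigroup (ℓ : Level) : Set (suc ℓ) where
  field
    Carrier : Set ℓ
    nonempty : Carrier
    _•_ : Carrier → Carrier → Maybe Carrier
    assoc : ∀ x y z → ((x • y) >>= λ xy → xy • z) ≡ ((y • z) >>= λ yz → x • yz)

module _ {ℓ : Level} (P : PartialSemigroup ℓ) where
  open PartialSemigroup P

  R : Carrier → Carrier → Set ℓ
  R x s = ∃ λ z → (x • s) ≡ just z

  L : Carrier → Carrier → Set ℓ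
  L x s = ∃ λ z → (s • x) ≡ just z

  IsIdempotent : Carrier → Set ℓ
  IsIdempotent e = (e • e) ≡ just e

  IsLeftIdentity : Carrier → Set ℓ
  IsLeftIdentity e = ∀ s → L s e × (e • s) ≡ just s

  IsRightIdentity : Carrier → Set ℓ
  IsRightIdentity e = ∀ s → R s e × (s • e) ≡ just s

  IsTwoSidedIdentity : Carrier → Set ℓ
  IsTwoSidedIdentity e = IsLeftIdentity e × IsRightIdentity e

  IsLeftInverse : Carrier → Carrier → Carrier → Set ℓ
  IsLeftInverse e x y = L x y × (y • x) ≡ just e

  IsRightInverse : Carrier → Carrier → Carrier → Set ℓ
  IsRightInverse e x y = R x y × (x • y) ≡ just e

  IsTwoSidedInverse : Carrier → Carrier → Carrier → Set ℓ
  IsTwoSidedInverse e x y = IsLeftInverse e x y × IsRightInverse e x y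

  IsPartialGroup : Set ℓ
  IsPartialGroup = ∃ λ e → IsIdempotent e × IsLeftIdentity e × (∀ x → ∃ λ y → IsLeftInverse e x y)

{-# OPTIONS --safe #-}
module Submission where

-- Let e be a left identity and x′ a left e-inverse of x.  Associativity applies along any
-- chain of defined products, so x″ • e = x″ • (x′ • x) = (x″ • x′) • x = e • x = x, hence
-- x • x′ = (x″ • e) • x′ = x″ • (e • x′) = x″ • x′ = e, and then x • e = x • (x′ • x) =
-- (x • x′) • x = x.  So e is a two-sided identity, left inverses are two-sided, and e is the
-- only left identity (f = f • e = e); idempotence of e is automatic.

open import Defs
open import Level using (Level)
open import Data.Product using (∃; _×_; _,_; proj₁; proj₂)
open import Data.Maybe using (just; _>>=_)
open import Data.Maybe.Properties using (just-injective)
open import Function.Bundles using (_⇔_; mk⇔)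
open import Relation.Binary.PropositionalEquality
  using (_≡_; sym; cong; subst; module ≡-Reasoning)

module PartialSemigroupProperties {ℓ : Level} (P : PartialSemigroup ℓ) where
  open PartialSemigroup P
  open ≡-Reasoning

  HasTwoSidedIdentityAndInverses : Set ℓ
  HasTwoSidedIdentityAndInverses =
    ∃ λ e → IsTwoSidedIdentity P e × (∀ x → ∃ λ y → (R P x y × L P x y) × IsTwoSidedInverse P e x y)

  HasLeftIdentity : Set ℓ
  HasLeftIdentity = ∃ λ e → IsLeftIdentity P e

  EveryLeftIdentityHasLeftInverses : Set ℓ
  EveryLeftIdentityHasLeftInverses =
    ∀ e → IsLeftIdentity P e → ∀ x → ∃ λ y → L P x y × IsLeftInverse P e x y

  assoc-defined : ∀ {x y z xy yz} → x • y ≡ just xy → y • z ≡ just yz → xy • z ≡ x • yz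
  assoc-defined {x} {y} {z} {xy} {yz} x•y≡xy y•z≡yz = begin
    xy • z                     ≡⟨ cong (_>>= λ w → w • z) x•y≡xy ⟨
    ((x • y) >>= λ w → w • z)  ≡⟨ assoc x y z ⟩
    ((y • z) >>= λ w → x • w)  ≡⟨ cong (_>>= λ w → x • w) y•z≡yz ⟩
    x • yz                     ∎

  leftIdentity⇒idempotent : ∀ {e} → IsLeftIdentity P e → IsIdempotent P e
  leftIdentity⇒idempotent {e} e-left = proj₂ (e-left e)

  module LeftIdentityWithLeftInverses
    (e : Carrier) (e-left : IsLeftIdentity P e) (inverses : ∀ x → ∃ λ y → IsLeftInverse P e x y)
    where

    identityˡ : ∀ x → e • x ≡ just x
    identityˡ x = proj₂ (e-left x)

    infix 30 _⁻¹
    _⁻¹ : Carrier → Carrier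
    x ⁻¹ = proj₁ (inverses x)

    inverseˡ : ∀ x → x ⁻¹ • x ≡ just e
    inverseˡ x = proj₂ (proj₂ (inverses x))

    inverse-inverse-identity : ∀ x → (x ⁻¹) ⁻¹ • e ≡ just x
    inverse-inverse-identity x = begin
      (x ⁻¹) ⁻¹ • e  ≡⟨ assoc-defined (inverseˡ (x ⁻¹)) (inverseˡ x) ⟨
      e • x          ≡⟨ identityˡ x ⟩
      just x         ∎

    inverseʳ : ∀ x → x • x ⁻¹ ≡ just e
    inverseʳ x = begin
      x • x ⁻¹          ≡⟨ assoc-defined (inverse-inverse-identity x) (identityˡ (x ⁻¹)) ⟩
      (x ⁻¹) ⁻¹ • x ⁻¹  ≡⟨ inverseˡ (x ⁻¹) ⟩
      just e            ∎

    identityʳ : ∀ x → x • e ≡ just x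
    identityʳ x = begin
      x • e   ≡⟨ assoc-defined (inverseʳ x) (inverseˡ x) ⟨
      e • x   ≡⟨ identityˡ x ⟩
      just x  ∎

    e-right : IsRightIdentity P e
    e-right x = (x , identityʳ x) , identityʳ x

    leftIdentity-unique : ∀ f → IsLeftIdentity P f → f ≡ e
    leftIdentity-unique f f-left = just-injective (begin
      just f  ≡⟨ identityʳ f ⟨
      f • e   ≡⟨ proj₂ (f-left e) ⟩
      just e  ∎)

    twoSidedInverses : ∀ x → ∃ λ y → (R P x y × L P x y) × IsTwoSidedInverse P e x y
    twoSidedInverses x =
      x ⁻¹ , ((e , inverseʳ x) , (e , inverseˡ x)) ,
      ((e , inverseˡ x) , inverseˡ x) , ((e , inverseʳ x) , inverseʳ x)

  partialGroup⇒twoSidedIdentityAndInverses : IsPartialGroup P → HasTwoSidedIdentityAndInverses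
  partialGroup⇒twoSidedIdentityAndInverses (e , _ , e-left , inverses) =
    e , (e-left , e-right) , twoSidedInverses
    where open LeftIdentityWithLeftInverses e e-left inverses

  twoSidedIdentityAndInverses⇒partialGroup : HasTwoSidedIdentityAndInverses → IsPartialGroup P
  twoSidedIdentityAndInverses⇒partialGroup (e , (e-left , _) , inverses) =
    e , leftIdentity⇒idempotent e-left , e-left ,
    λ x → proj₁ (inverses x) , proj₁ (proj₂ (proj₂ (inverses x)))

  partialGroup⇒leftInverses : IsPartialGroup P → HasLeftIdentity × EveryLeftIdentityHasLeftInverses
  partialGroup⇒leftInverses (e , _ , e-left , inverses) = (e , e-left) , inversesFor
    where
    open LeftIdentityWithLeftInverses e e-left inverses

    inversesFor : EveryLeftIdentityHasLeftInverses
    inversesFor f f-left x =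
      subst (λ g → ∃ λ y → L P x y × IsLeftInverse P g x y) (sym (leftIdentity-unique f f-left))
        (x ⁻¹ , proj₁ (proj₂ (inverses x)) , proj₂ (inverses x))

  leftInverses⇒partialGroup : HasLeftIdentity × EveryLeftIdentityHasLeftInverses → IsPartialGroup P
  leftInverses⇒partialGroup ((e , e-left) , inverses) =
    e , leftIdentity⇒idempotent e-left , e-left ,
    λ x → proj₁ (inverses e e-left x) , proj₂ (proj₂ (inverses e e-left x))

open PartialSemigroupProperties

lemma2p9 : {ℓ : Level} (P : PartialSemigroup ℓ) →
    (IsPartialGroup P ⇔ (∃ λ e → IsTwoSidedIdentity P e × (∀ x → ∃ λ y → (R P x y × L P x y) × IsTwoSidedInverse P e x y)))
    × (IsPartialGroup P ⇔ ((∃ λ e → IsLeftIdentity P e) × (∀ e → IsLeftIdentity P e → ∀ x → ∃ λ y → L P x y × IsLeftInverse P e x y)))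
lemma2p9 P =
  mk⇔ (partialGroup⇒twoSidedIdentityAndInverses P) (twoSidedIdentityAndInverses⇒partialGroup P) ,
  mk⇔ (partialGroup⇒leftInverses P) (leftInverses⇒partialGroup P)
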